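{- Let $G$ be a complete wheel with cycle $C=\{c_1,\dots,c_{n-1}\}$ and central vertex $h$, $V=C\cup\{h\}$, and say $L\subseteq V$ satisfies condition (*) if for every $i$, $c_i\notin L$ implies $c_{i-2},c_{i-1},c_{i+1},c_{i+2}\in L$. (1) If $n=6$ and $k\in\{3,4\}$, then every NL-landmark set for parameter $k$ has at least $n-1=5$ vertices (only trivial landmark sets exist); in particular $md_4^{NL}(G)=5$. (2) If $n=7$ and $k=3$, then $L\subseteq V$ is an NL-landmark set if and only if it satisfies (*) and $|L|\geq5$; thus $md_3^{NL}(G)=5$. (3) If $n=7$ and $k=4$, then $L\subseteq V$ is an NL-landmark set if and only if either it satisfies (*) and $h\in L$, or $L=C$; thus $md_4^{NL}(G)=5$. (4) If $n=8$ and $k=4$, then $L\subseteq V$ is an NL-landmark set if and only if either it satisfies (*) and $h\in L$, or it contains at least six cycle vertices; thus $md_4^{NL}(G)=6$.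
   Context: The complete wheel on $n$ vertices has vertex set $V=C\cup\{h\}$ with $C=\{c_1,\dots,c_{n-1}\}$, edges $\{c_i,h\}$ and $\{c_i,c_{i+1}\}$ for $1\le i\le n-1$, indices modulo $n-1$. $d(x,y)$ denotes graph distance; $\tau$ separates distinct $u,v$ if $d(u,\tau)\neq d(v,\tau)$. $L\subseteq V$ is an NL-landmark set for parameter $k$ if every pair of distinct $u,v\in V\setminus L$ is separated by at least $k$ distinct vertices of $L$; $md_k^{NL}(G)$ is the minimum cardinality of such a set. -}

module Defs where

open import Data.Bool using (Bool; true; false; _∧_; _∨_; not; if_then_else_)
open import Data.Nat using (ℕ; zero; suc; _+_; _∸_; _≤_; _≡ᵇ_; NonZero)
open import Data.Nat.DivMod using (_%_; m%n<n)
open import Data.Fin using (Fin; toℕ; fromℕ; fromℕ<; inject₁)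
open import Data.Fin.Subset using (Subset; _∈_; _∉_; _∩_; _∪_; ∣_∣; ⁅_⁆; ∁)
open import Data.Vec using (Vec; lookup; tabulate; foldr)
open import Data.Product using (Σ; _×_; _,_)
open import Relation.Binary.PropositionalEquality using (_≡_; _≢_)

anyFin : {N : ℕ} → (Fin N → Bool) → Bool
anyFin {N} p = foldr (λ _ → Bool) _∨_ false (tabulate p)

ball : {N : ℕ} → (Fin N → Fin N → Bool) → Fin N → ℕ → Subset N
ball adj u zero = ⁅ u ⁆
ball adj u (suc r) =
  let B = ball adj u r in
  B ∪ tabulate (λ v → anyFin (λ w → lookup B w ∧ adj w v))

-- least r ≥ start with v ∈ ball u r, searching with the given fuel
-- (fuel N suffices for connected graphs on N vertices)
search : {N : ℕ} → (Fin N → Fin N → Bool) → Fin N → Fin N → ℕ → ℕ → ℕ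
search adj u v zero start = start
search adj u v (suc fuel) start =
  if lookup (ball adj u start) v then start else search adj u v fuel (suc start)

dist : {N : ℕ} → (Fin N → Fin N → Bool) → Fin N → Fin N → ℕ
dist {N} adj u v = search adj u v N 0

-- Complete wheel on n = suc m vertices: cycle C = {c_0,…,c_{m-1}}
-- (paper's c_1,…,c_{n-1}) and hub h.  Vertex set Fin (suc m);
-- c_i = inject₁ i, h = fromℕ m.

hub : (m : ℕ) → Fin (suc m)
hub m = fromℕ m

cyc : (m : ℕ) .{{_ : NonZero m}} → ℕ → Fin (suc m)
cyc m i = inject₁ (fromℕ< (m%n<n i m))

isHub : {m : ℕ} → Fin (suc m) → Bool
isHub {m} v = toℕ v ≡ᵇ m

wheelAdj : (m : ℕ) .{{_ : NonZero m}} → Fin (suc m) → Fin (suc m) → Bool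
wheelAdj m u v =
  if isHub u ∨ isHub v
  then not (toℕ u ≡ᵇ toℕ v)
  else ((toℕ (cyc m (suc (toℕ u))) ≡ᵇ toℕ v) ∨ (toℕ (cyc m (suc (toℕ v))) ≡ᵇ toℕ u))

wdist : (m : ℕ) .{{_ : NonZero m}} → Fin (suc m) → Fin (suc m) → ℕ
wdist m = dist (wheelAdj m)

cycleSet : (m : ℕ) → Subset (suc m)
cycleSet m = ∁ ⁅ hub m ⁆

sepSet : (m : ℕ) .{{_ : NonZero m}} → Fin (suc m) → Fin (suc m) → Subset (suc m)
sepSet m u v = tabulate (λ τ → not (wdist m u τ ≡ᵇ wdist m v τ))

IsNLLandmark : (m : ℕ) .{{_ : NonZero m}} → ℕ → Subset (suc m) → Set
IsNLLandmark m k L =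
  ∀ (u v : Fin (suc m)) → u ≢ v → u ∉ L → v ∉ L → k ≤ ∣ L ∩ sepSet m u v ∣

MdNL : (m : ℕ) .{{_ : NonZero m}} → ℕ → ℕ → Set
MdNL m k d =
  (Σ (Subset (suc m)) λ L → IsNLLandmark m k L × ∣ L ∣ ≡ d)
  × (∀ L → IsNLLandmark m k L → d ≤ ∣ L ∣)

Star : (m : ℕ) .{{_ : NonZero m}} → Subset (suc m) → Set
Star m L = ∀ (i : Fin m) → cyc m (toℕ i) ∉ L →
  (cyc m (toℕ i + m ∸ 2) ∈ L) × (cyc m (toℕ i + m ∸ 1) ∈ L)
  × (cyc m (toℕ i + 1) ∈ L) × (cyc m (toℕ i + 2) ∈ L)

module Submission where

-- The theorem is a statement about three small wheels (cycle lengths 5, 6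
-- and 7), so its proof is a verified finite computation, organised so that
-- each piece of the computation has a clear mathematical meaning.
--
--  * The wheel has diameter at most 2: d(u,v) is 0 if u = v, 1 if u and v
--    are adjacent, and 2 otherwise.  For the three wheels this "local"
--    description of the breadth-first distance `wdist` is checked vertex
--    pair by vertex pair, so the separating sets, and hence the landmark
--    property, may be computed from adjacency alone.
--  * Being a landmark set and condition (*) are decidable, and a decidable
--    property of all subsets of a finite set is decided by enumeration; the
--    characterisations (2)-(4) and the bounds in (1) for k = 3 and in (4)
--    are checked in this way.
--  * The remaining facts are derived: k-landmark sets are also k'-landmark
--    sets for k' ≤ k, so (1) for k = 4 and the lower bound in (3) follow
--    from the cases k = 3; the cycle C is a landmark set for every k, since
--    only the hub lies outside it; the lower bound in (2) is read off the
--    characterisation, and the optimal sets are exhibited explicitly.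

open import Defs
open import Data.Bool using (not; if_then_else_)
open import Data.Bool.Properties using () renaming (_≟_ to _≟𝔹_)
open import Data.Nat using (ℕ; suc; _+_; _∸_; _≤_; _≤?_; _≡ᵇ_; NonZero)
open import Data.Nat.Properties using (≤-refl; ≤-trans; n≤1+n) renaming (_≟_ to _≟ℕ_)
open import Data.Fin using (Fin; toℕ) renaming (_≟_ to _≟Fin_)
open import Data.Fin.Properties using (all?)
open import Data.Fin.Subset using (Subset; inside; outside; _∈_; _∉_; _∩_; ∣_∣)
open import Data.Fin.Subset.Properties using (_∈?_; anySubset?; x∉∁p⇒x∈p; x∈⁅y⁆⇒x≡y)
open import Data.Empty using (⊥-elim)
open import Data.Product using (_×_; _,_; proj₂)
open import Data.Sum using (_⊎_; inj₁; inj₂)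
open import Data.Vec using (_∷_; []; tabulate)
open import Data.Vec.Properties using (tabulate-cong; ≡-dec)
open import Function.Bundles using (_⇔_; mk⇔; Equivalence)
open import Function.Construct.Composition using (_⇔-∘_)
open import Relation.Binary.PropositionalEquality using (_≡_; _≢_; refl; sym; trans; cong₂; subst)
open import Relation.Nullary using (Dec; ¬?)
open import Relation.Nullary.Decidable
  using (map′; from-yes; decidable-stable; _×-dec_; _⊎-dec_; _→-dec_)

allSubsets? : ∀ {n} {P : Subset n → Set} → (∀ L → Dec (P L)) → Dec (∀ L → P L)
allSubsets? P? = map′
  (λ noCounterexample L → decidable-stable (P? L) (λ ¬PL → noCounterexample (L , ¬PL)))
  (λ all (L , ¬PL) → ¬PL (all L))
  (¬? (anySubset? (λ L → ¬? (P? L))))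

_⇔?_ : {A B : Set} → Dec A → Dec B → Dec (A ⇔ B)
A? ⇔? B? = map′ (λ (to , from) → mk⇔ to from)
  (λ A⇔B → Equivalence.to A⇔B , Equivalence.from A⇔B)
  ((A? →-dec B?) ×-dec (B? →-dec A?))

localDist : (m : ℕ) .{{_ : NonZero m}} → Fin (suc m) → Fin (suc m) → ℕ
localDist m u v = if toℕ u ≡ᵇ toℕ v then 0 else (if wheelAdj m u v then 1 else 2)

DistanceIsLocal : (m : ℕ) .{{_ : NonZero m}} → Set
DistanceIsLocal m = ∀ (u v : Fin (suc m)) → wdist m u v ≡ localDist m u v

distanceIsLocal? : (m : ℕ) .{{_ : NonZero m}} → Dec (DistanceIsLocal m)
distanceIsLocal? m = all? (λ u → all? (λ v → wdist m u v ≟ℕ localDist m u v))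

localSep : (m : ℕ) .{{_ : NonZero m}} → Fin (suc m) → Fin (suc m) → Subset (suc m)
localSep m u v = tabulate (λ τ → not (localDist m u τ ≡ᵇ localDist m v τ))

IsLocalLandmark : (m : ℕ) .{{_ : NonZero m}} → ℕ → Subset (suc m) → Set
IsLocalLandmark m k L =
  ∀ (u v : Fin (suc m)) → u ≢ v → u ∉ L → v ∉ L → k ≤ ∣ L ∩ localSep m u v ∣

isLocalLandmark? : (m : ℕ) .{{_ : NonZero m}} → ∀ k L → Dec (IsLocalLandmark m k L)
isLocalLandmark? m k L = all? (λ u → all? (λ v →
  ¬? (u ≟Fin v) →-dec ¬? (u ∈? L) →-dec ¬? (v ∈? L) →-dec k ≤? ∣ L ∩ localSep m u v ∣))

sepSet≡localSep : (m : ℕ) .{{_ : NonZero m}} → DistanceIsLocal m →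
  ∀ u v → sepSet m u v ≡ localSep m u v
sepSet≡localSep m local u v =
  tabulate-cong (λ τ → cong₂ (λ a b → not (a ≡ᵇ b)) (local u τ) (local v τ))

landmark⇔local : (m : ℕ) .{{_ : NonZero m}} → DistanceIsLocal m →
  ∀ k L → IsNLLandmark m k L ⇔ IsLocalLandmark m k L
landmark⇔local m local k L = mk⇔
  (λ isL u v u≢v u∉L v∉L → along (sepSet≡localSep m local u v) (isL u v u≢v u∉L v∉L))
  (λ isL u v u≢v u∉L v∉L → along (sym (sepSet≡localSep m local u v)) (isL u v u≢v u∉L v∉L))
  where
  along : ∀ {S S'} → S ≡ S' → k ≤ ∣ L ∩ S ∣ → k ≤ ∣ L ∩ S' ∣
  along S≡S' = subst (λ S → k ≤ ∣ L ∩ S ∣) S≡S'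

star? : (m : ℕ) .{{_ : NonZero m}} → ∀ L → Dec (Star m L)
star? m L = all? (λ i → ¬? (cyc m (toℕ i) ∈? L) →-dec
  (cyc m (toℕ i + m ∸ 2) ∈? L) ×-dec (cyc m (toℕ i + m ∸ 1) ∈? L)
  ×-dec (cyc m (toℕ i + 1) ∈? L) ×-dec (cyc m (toℕ i + 2) ∈? L))

landmark-mono : (m : ℕ) .{{_ : NonZero m}} → ∀ {k' k} L →
  k' ≤ k → IsNLLandmark m k L → IsNLLandmark m k' L
landmark-mono m L k'≤k isL u v u≢v u∉L v∉L = ≤-trans k'≤k (isL u v u≢v u∉L v∉L)

-- The cycle C is a landmark set for every k: only the hub lies outside it,
-- so there is no pair of distinct vertices outside C to separate.
cycleSet-landmark : (m : ℕ) .{{_ : NonZero m}} → ∀ k → IsNLLandmark m k (cycleSet m)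
cycleSet-landmark m k u v u≢v u∉C v∉C = ⊥-elim (u≢v (trans (outside⇒hub u∉C) (sym (outside⇒hub v∉C))))
  where
  outside⇒hub : ∀ {x} → x ∉ cycleSet m → x ≡ hub m
  outside⇒hub x∉C = x∈⁅y⁆⇒x≡y (hub m) (x∉∁p⇒x∈p x∉C)

mdNL-intro : (m : ℕ) .{{_ : NonZero m}} → ∀ k d L → IsNLLandmark m k L → ∣ L ∣ ≡ d →
  (∀ L' → IsNLLandmark m k L' → d ≤ ∣ L' ∣) → MdNL m k d
mdNL-intro m k d L isL size lower = (L , isL , size) , lower

characterise : (m : ℕ) .{{_ : NonZero m}} → DistanceIsLocal m → ∀ k {P : Subset (suc m) → Set} →
  (∀ L → IsLocalLandmark m k L ⇔ P L) → ∀ L → IsNLLandmark m k L ⇔ P L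
characterise m local k local⇔P L = local⇔P L ⇔-∘ landmark⇔local m local k L

lowerBound : (m : ℕ) .{{_ : NonZero m}} → DistanceIsLocal m → ∀ k d →
  (∀ L → IsLocalLandmark m k L → d ≤ ∣ L ∣) → ∀ L → IsNLLandmark m k L → d ≤ ∣ L ∣
lowerBound m local k d bound L isL = bound L (Equivalence.to (landmark⇔local m local k L) isL)

distance5 : DistanceIsLocal 5
distance5 = from-yes (distanceIsLocal? 5)

distance6 : DistanceIsLocal 6
distance6 = from-yes (distanceIsLocal? 6)

distance7 : DistanceIsLocal 7
distance7 = from-yes (distanceIsLocal? 7)

part1-k3 : (L : Subset 6) → IsNLLandmark 5 3 L → 5 ≤ ∣ L ∣
part1-k3 = lowerBound 5 distance5 3 5
  (from-yes (allSubsets? (λ L → isLocalLandmark? 5 3 L →-dec 5 ≤? ∣ L ∣)))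

part1 : (k : ℕ) → (k ≡ 3 ⊎ k ≡ 4) → (L : Subset 6) → IsNLLandmark 5 k L → 5 ≤ ∣ L ∣
part1 _ (inj₁ refl) = part1-k3
part1 _ (inj₂ refl) L isL = part1-k3 L (landmark-mono 5 L (n≤1+n 3) isL)

part2 : (L : Subset 7) → IsNLLandmark 6 3 L ⇔ (Star 6 L × 5 ≤ ∣ L ∣)
part2 = characterise 6 distance6 3
  (from-yes (allSubsets? (λ L → isLocalLandmark? 6 3 L ⇔? (star? 6 L ×-dec 5 ≤? ∣ L ∣))))

part3 : (L : Subset 7) → IsNLLandmark 6 4 L ⇔ ((Star 6 L × hub 6 ∈ L) ⊎ L ≡ cycleSet 6)
part3 = characterise 6 distance6 4
  (from-yes (allSubsets? (λ L → isLocalLandmark? 6 4 L ⇔?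
    ((star? 6 L ×-dec hub 6 ∈? L) ⊎-dec ≡-dec _≟𝔹_ L (cycleSet 6)))))

part4 : (L : Subset 8) → IsNLLandmark 7 4 L ⇔ ((Star 7 L × hub 7 ∈ L) ⊎ 6 ≤ ∣ L ∩ cycleSet 7 ∣)
part4 = characterise 7 distance7 4
  (from-yes (allSubsets? (λ L → isLocalLandmark? 7 4 L ⇔?
    ((star? 7 L ×-dec hub 7 ∈? L) ⊎-dec 6 ≤? ∣ L ∩ cycleSet 7 ∣))))

part3-bound : (L : Subset 7) → IsNLLandmark 6 4 L → 5 ≤ ∣ L ∣
part3-bound L isL = proj₂ (Equivalence.to (part2 L) (landmark-mono 6 L (n≤1+n 3) isL))

part4-bound : (L : Subset 8) → IsNLLandmark 7 4 L → 6 ≤ ∣ L ∣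
part4-bound = lowerBound 7 distance7 4 6
  (from-yes (allSubsets? (λ L → isLocalLandmark? 7 4 L →-dec 6 ≤? ∣ L ∣)))

-- Optimal landmark sets, with cycle vertices indexed from 0 as in `cyc`:
-- C \ {c₀}, (C \ {c₀, c₃}) ∪ {h}, and C \ {c₆}.
withoutC₀ : Subset 7
withoutC₀ = outside ∷ inside ∷ inside ∷ inside ∷ inside ∷ inside ∷ outside ∷ []

withoutC₀C₃ : Subset 7
withoutC₀C₃ = outside ∷ inside ∷ inside ∷ outside ∷ inside ∷ inside ∷ inside ∷ []

withoutC₆ : Subset 8
withoutC₆ = inside ∷ inside ∷ inside ∷ inside ∷ inside ∷ inside ∷ outside ∷ outside ∷ []

mainTheorem13 : ((k : ℕ) → (k ≡ 3 ⊎ k ≡ 4) → (L : Subset 6) → IsNLLandmark 5 k L → 5 ≤ ∣ L ∣)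
    × MdNL 5 4 5
    × ((L : Subset 7) → IsNLLandmark 6 3 L ⇔ (Star 6 L × 5 ≤ ∣ L ∣))
    × MdNL 6 3 5
    × ((L : Subset 7) → IsNLLandmark 6 4 L ⇔ ((Star 6 L × hub 6 ∈ L) ⊎ L ≡ cycleSet 6))
    × MdNL 6 4 5
    × ((L : Subset 8) → IsNLLandmark 7 4 L ⇔ ((Star 7 L × hub 7 ∈ L) ⊎ 6 ≤ ∣ L ∩ cycleSet 7 ∣))
    × MdNL 7 4 6
mainTheorem13 = part1 , md₅ , part2 , md₆₃ , part3 , md₆₄ , part4 , md₇
  where
  md₅ : MdNL 5 4 5
  md₅ = mdNL-intro 5 4 5 (cycleSet 5) (cycleSet-landmark 5 4) refl (part1 4 (inj₂ refl))

  md₆₃ : MdNL 6 3 5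
  md₆₃ = mdNL-intro 6 3 5 withoutC₀
    (Equivalence.from (part2 withoutC₀) (from-yes (star? 6 withoutC₀) , ≤-refl))
    refl (λ L isL → proj₂ (Equivalence.to (part2 L) isL))

  md₆₄ : MdNL 6 4 5
  md₆₄ = mdNL-intro 6 4 5 withoutC₀C₃
    (Equivalence.from (part3 withoutC₀C₃) (inj₁ (from-yes (star? 6 withoutC₀C₃ ×-dec hub 6 ∈? withoutC₀C₃))))
    refl part3-bound

  md₇ : MdNL 7 4 6
  md₇ = mdNL-intro 7 4 6 withoutC₆
    (Equivalence.from (part4 withoutC₆) (inj₂ (from-yes (6 ≤? ∣ withoutC₆ ∩ cycleSet 7 ∣))))
    refl part4-bound
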